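{- Parikh composition need not have right units: there exists a set $X$ such that there is no relation $\iota:X\rightharpoonup\wp(X)$ satisfying $\alpha\diamond\iota=\alpha$ for all relations $\alpha:X\rightharpoonup\wp(X)$.
   Context: A relation $\alpha:X\rightharpoonup Y$ is a subset of $X\times Y$; relational composition is written by juxtaposition. For $\beta:Y\rightharpoonup\wp(Z)$, the Parikh lifting $\beta_\diamond:\wp(Y)\rightharpoonup\wp(Z)$ is given by $(B,A)\in\beta_\diamond$ iff $\forall b\in B.\,(b,A)\in\beta$. The Parikh composition of $\alpha:X\rightharpoonup\wp(Y)$ and $\beta:Y\rightharpoonup\wp(Z)$ is $\alpha\diamond\beta=\alpha\beta_\diamond$, i.e. $(a,A)\in\alpha\diamond\beta$ iff $\exists B.\,(a,B)\in\alpha\wedge\forall b\in B.\,(b,A)\in\beta$. -}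

module Defs where

open import Level using (0ℓ)
open import Data.Product using (Σ; _×_)
open import Relation.Unary using (Pred; _∈_; _≐_)
open import Function.Bundles using (_⇔_)

℘ : Set → Set₁
℘ X = Pred X 0ℓ

-- A relation α : X ⇀ ℘(Y) is a subset of X × ℘(Y).
PRel : Set → Set → Set₁
PRel X Y = X → ℘ Y → Set

-- Relations on X × ℘(Y) should only depend on the subset extensionally
-- (℘(Y) is a set of sets: equal elements are equal subsets).
Extensional : {X Y : Set} → PRel X Y → Set₁
Extensional {X} {Y} α = (x : X) (A A′ : ℘ Y) → A ≐ A′ → α x A → α x A′

_⋄_ : {X Y Z : Set} → PRel X Y → PRel Y Z → X → ℘ Z → Set₁
(α ⋄ β) a A = Σ (℘ _) λ B → α a B × (∀ b → b ∈ B → β b A)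

_≡Rel_ : {X Y : Set} → (X → ℘ Y → Set₁) → PRel X Y → Set₁
ρ ≡Rel α = ∀ a A → ρ a A ⇔ α a A

-- If α relates a to the empty set, then α ⋄ β relates a to every subset, vacuously
-- through B = ∅. So α := {(x , ∅) | x ∈ X} is extensional, yet over an inhabited X
-- its Parikh composite with any ι also contains (x , X), which α does not.
module Submission where

open import Defs
open import Data.Product using (Σ; _×_; _,_; proj₂)
open import Data.Unit using (⊤; tt)
open import Function.Bundles using (Equivalence)
open import Relation.Nullary using (¬_)
open import Relation.Unary using (∅; U; Empty)

⋄-total-at-∅ : {X Y Z : Set} (α : PRel X Y) (β : PRel Y Z) {a : X} →
               α a ∅ → (A : ℘ Z) → (α ⋄ β) a A
⋄-total-at-∅ α β α-a-∅ A = ∅ , α-a-∅ , λ _ ()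

onlyEmpty : {X Y : Set} → PRel X Y
onlyEmpty _ B = Empty B

onlyEmpty-extensional : {X Y : Set} → Extensional (onlyEmpty {X} {Y})
onlyEmpty-extensional _ _ _ A≐A′ A-empty y y∈A′ = A-empty y (proj₂ A≐A′ y∈A′)

no-right-unit : {X : Set} → X →
                ¬ (Σ (PRel X X) λ ι → Extensional ι ×
                   ((α : PRel X X) → Extensional α → (α ⋄ ι) ≡Rel α))
no-right-unit {X} x (ι , _ , ι-right-unit) = U-not-empty (Equivalence.to
  (ι-right-unit onlyEmpty onlyEmpty-extensional x U)
  (⋄-total-at-∅ (onlyEmpty {X} {X}) ι {x} (λ _ ()) U))
  where
  U-not-empty : ¬ Empty U
  U-not-empty U-empty = U-empty x tt

proposition5p3 : Σ Set λ X →
    ¬ (Σ (PRel X X) λ ι → Extensional ι ×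
    ((α : PRel X X) → Extensional α → (α ⋄ ι) ≡Rel α))
proposition5p3 = ⊤ , no-right-unit tt
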